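{- Let $G$ be a finite simple graph with connected components $G_1,\dots,G_k$. Then the nested complex $\mathcal{N}(G)$ is the join of $\mathcal{N}(G_1),\dots,\mathcal{N}(G_k)$. Moreover, for any maximal tubings $\mathcal{T}^\circ_1,\dots,\mathcal{T}^\circ_k$ on $G_1,\dots,G_k$, the compatibility fan of $G$ with respect to $\mathcal{T}^\circ=\mathcal{T}^\circ_1\cup\dots\cup\mathcal{T}^\circ_k$ is the product of the compatibility fans: \[ \mathcal{C}(G,\mathcal{T}^\circ)=\{C_1\times\dots\times C_k : C_i\in\mathcal{C}(G_i,\mathcal{T}^\circ_i)\text{ for all }i\in[k]\}, \] where $\mathbb{R}^{\mathcal{T}^\circ}$ is identified with $\mathbb{R}^{\mathcal{T}^\circ_1}\times\dots\times\mathbb{R}^{\mathcal{T}^\circ_k}$.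
   Context: For a finite simple graph $G$ with vertex set $V$: a tube is a nonempty subset of $V$ inducing a connected subgraph, proper if it is not a connected component. Two tubes are compatible if nested or disjoint and non-adjacent (their union is not a tube). A tubing is a set of pairwise compatible proper tubes; the nested complex $\mathcal{N}(G)$ is the simplicial complex of tubings. The compatibility degree is $\delta(T\,\|\,T')=-1$ if $T=T'$; the number of vertices of $T'\setminus T$ adjacent to $T$ if $T\not\subseteq T'$; $0$ otherwise. For a maximal tubing $\mathcal{T}^\circ$, the compatibility vector of a tube $T$ is $\mathbf{d}(\mathcal{T}^\circ,T)=(\delta(T^\circ\,\|\,T))_{T^\circ\in\mathcal{T}^\circ}\in\mathbb{R}^{\mathcal{T}^\circ}$, and the compatibility fan $\mathcal{C}(G,\mathcal{T}^\circ)$ is the collection of cones $\mathbb{R}_{\ge0}\{\mathbf{d}(\mathcal{T}^\circ,T):T\in\mathcal{T}\}$ over all tubings $\mathcal{T}$ of $G$.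
   Formalization: The cones of the compatibility fans of G and of G_1, …, G_k are taken in ℚ^𝒯°, as nonnegative rational combinations of the compatibility vectors, rather than in ℝ^𝒯°. -}

module Defs where

import Level
open import Level using (0ℓ) renaming (suc to lsuc)
open import Data.Nat using (ℕ)
open import Data.Bool using (Bool; true; false; _∧_)
import Data.Bool as Bool
open import Data.Fin using (Fin)
open import Data.Fin.Subset using (Subset; _∈_; _⊆_; _∪_; _∩_; _─_; ∣_∣; Nonempty; Empty; ⊤)
open import Data.Fin.Subset.Properties using (_⊆?_)
open import Data.Vec using (tabulate; lookup)
open import Data.Vec.Properties using (≡-dec)
open import Data.List using (List; []; _∷_; allFin)
open import Data.Bool.ListAction using (any)
open import Data.List.Relation.Unary.All using (All)
open import Data.Product using (Σ; ∃; _×_; _,_; proj₁; proj₂)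
open import Data.Sum using (_⊎_)
open import Data.Integer using (+_)
open import Data.Rational using (ℚ; 0ℚ; 1ℚ; -_; _≤_; _*_; _+_; _/_)
open import Relation.Binary.PropositionalEquality using (_≡_)
open import Relation.Nullary using (¬_; yes; no)
open import Function.Bundles using (_⇔_)

record Graph (n : ℕ) : Set where
  field
    adj        : Fin n → Fin n → Bool
    adj-sym    : ∀ u v → adj u v ≡ adj v u
    adj-irrefl : ∀ v → adj v v ≡ false
open Graph public

module _ {n : ℕ} (G : Graph n) where

  Adjacent : Fin n → Fin n → Set
  Adjacent u v = adj G u v ≡ true

  data Path (T : Subset n) : Fin n → Fin n → Set where
    stop : ∀ {u} → u ∈ T → Path T u u
    step : ∀ {u w v} → u ∈ T → Adjacent u w → Path T w v → Path T u v

  Connected : Subset n → Set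
  Connected T = Nonempty T × (∀ {u v} → u ∈ T → v ∈ T → Path T u v)

  -- Everything below is relative to the induced subgraph G[W], W ⊆ V.
  -- (G itself is G[⊤]; a connected component G_i of G is G[C_i].)

  IsTube : Subset n → Subset n → Set
  IsTube W T = T ⊆ W × Connected T

  IsComponent : Subset n → Subset n → Set
  IsComponent W C = IsTube W C × (∀ D → IsTube W D → C ⊆ D → D ≡ C)

  IsProperTube : Subset n → Subset n → Set
  IsProperTube W T = IsTube W T × ¬ IsComponent W T

  -- nested, or disjoint and non-adjacent (union is not a tube)
  Compatible : Subset n → Subset n → Subset n → Set
  Compatible W T T' =
    T ⊆ T' ⊎ T' ⊆ T ⊎ (Empty (T ∩ T') × ¬ IsTube W (T ∪ T'))

Family : ℕ → Set₁
Family n = Subset n → Set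

_⊆ᶠ_ : ∀ {n} → Family n → Family n → Set
𝒯 ⊆ᶠ 𝒯' = ∀ T → 𝒯 T → 𝒯' T

_≐ᶠ_ : ∀ {n} → Family n → Family n → Set
𝒯 ≐ᶠ 𝒯' = (𝒯 ⊆ᶠ 𝒯') × (𝒯' ⊆ᶠ 𝒯)

⋃ᶠ : ∀ {n k} → (Fin k → Family n) → Family n
⋃ᶠ {k = k} Fs T = Σ (Fin k) λ i → Fs i T

-- a simplicial complex on (a subset of) the proper tubes, given by its faces
Complex : ℕ → Set₂
Complex n = Family n → Set₁

Join : ∀ {n k} → (Fin k → Complex n) → Complex n
Join {n} {k} Δs 𝒯 =
  Σ (Fin k → Family n) λ Fs → (∀ i → Δs i (Fs i)) × (𝒯 ≐ᶠ ⋃ᶠ Fs)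

module _ {n : ℕ} (G : Graph n) where

  IsTubing : Subset n → Family n → Set
  IsTubing W 𝒯 = (∀ T → 𝒯 T → IsProperTube G W T)
               × (∀ T T' → 𝒯 T → 𝒯 T' → Compatible G W T T')

  NestedComplex : Subset n → Complex n
  -- (lifted to Set₁ only so that it has the type Complex n)
  NestedComplex W 𝒯 = Level.Lift (lsuc 0ℓ) (IsTubing W 𝒯)

  IsMaximalTubing : Subset n → Family n → Set₁
  IsMaximalTubing W 𝒯 = IsTubing W 𝒯 × (∀ 𝒯' → IsTubing W 𝒯' → 𝒯 ⊆ᶠ 𝒯' → 𝒯' ⊆ᶠ 𝒯)

  nbr : Subset n → Subset n
  nbr T = tabulate λ v → any (λ u → lookup T u ∧ adj G u v) (allFin n)

  δ : Subset n → Subset n → ℚ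
  δ T T' with ≡-dec Bool._≟_ T T'
  ... | yes _ = - 1ℚ
  ... | no _ with T ⊆? T'
  ...   | yes _ = 0ℚ
  ...   | no _  = (+ ∣ (T' ─ T) ∩ nbr T ∣) / 1

-- A vector of ℚ^{𝒯°} is represented by a function x : Subset n → ℚ of
-- which only the coordinates x S with S ∈ 𝒯° are relevant.

Vect : ℕ → Set
Vect n = Subset n → ℚ

Cone : ℕ → Set₁
Cone n = Vect n → Set

module _ {n : ℕ} (G : Graph n) where

  -- Σ_j c_j · d(𝒯°, T_j) evaluated at coordinate S
  lincomb : List (ℚ × Subset n) → Subset n → ℚ
  lincomb []             S = 0ℚ
  lincomb ((c , T) ∷ l) S = c * δ G S T + lincomb l S

  InCone : Family n → Family n → Vect n → Set
  InCone 𝒯° 𝒯 x =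
    Σ (List (ℚ × Subset n)) λ l →
      All (λ p → (0ℚ ≤ proj₁ p) × 𝒯 (proj₂ p)) l
      × (∀ S → 𝒯° S → x S ≡ lincomb l S)

  _≐ᶜ_ : Cone n → Cone n → Set
  K ≐ᶜ K' = ∀ x → K x ⇔ K' x

  InFan : Subset n → Family n → Cone n → Set₁
  InFan W 𝒯° K = Σ (Family n) λ 𝒯 → IsTubing G W 𝒯 × (K ≐ᶜ InCone 𝒯° 𝒯)

  -- K ∈ { C₁ × … × Cₖ : Cᵢ ∈ C(Gᵢ, 𝒯°ᵢ) },  ℚ^{𝒯°} ≅ ∏ ℚ^{𝒯°ᵢ}
  InProductFan : ∀ {k} → (Fin k → Subset n) → (Fin k → Family n) → Cone n → Set₁
  InProductFan {k} Cs Ts K =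
    Σ (Fin k → Cone n) λ Ks →
      (∀ i → InFan (Cs i) (Ts i) (Ks i)) × (K ≐ᶜ (λ x → ∀ i → Ks i x))

  IsComponentList : ∀ {k} → (Fin k → Subset n) → Set
  IsComponentList {k} Cs =
    (∀ i → IsComponent G ⊤ (Cs i))
    × (∀ i j → Cs i ≡ Cs j → i ≡ j)
    × (∀ C → IsComponent G ⊤ C → ∃ λ i → Cs i ≡ C)

-- Every tube is connected, hence lies inside a unique component, and tubes
-- in different components are automatically compatible (disjoint, and their
-- union is disconnected).  Being a proper tube, and compatibility, inside a
-- component Cᵢ is the same as in G.  So a tubing of G is exactly a union of
-- tubings of the components (part 1).  For the fans, the compatibility
-- degree δ(S ‖ T) vanishes when S and T lie in different components, so a
-- compatibility vector d(𝒯°, T) with T ⊆ Cⱼ is zero on all coordinates of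
-- 𝒯°ᵢ, i ≠ j: a nonnegative combination of generators splits into its
-- component parts, and conversely the parts can be concatenated (part 2).
module Submission where

open import Defs
open import Data.Nat using (ℕ)
open import Data.Fin using (Fin)
open import Data.Fin.Subset using (Subset; ⊤)
open import Data.Product using (_×_)
open import Function.Bundles using (_⇔_)

import Level
open import Data.Nat as ℕ using (zero; suc)
import Data.Nat.Properties as ℕₚ
open import Data.Fin using () renaming (zero to fzero; suc to fsuc; _≟_ to _≟ᶠ_)
import Data.Fin.Properties as Fin
open import Data.Fin.Subset using (_∈_; _∉_; _⊆_; _∪_; _∩_; _─_; ∣_∣; Nonempty; Empty; ⁅_⁆)
open import Data.Fin.Subset.Properties
  using (p⊆p∪q; q⊆p∪q; x∈p∪q⁻; x∈p∩q⁻; p─q⊆p; ⊆⊤; ⊆-antisym; Empty-unique; ∣⊥∣≡0; _⊆?_; _∈?_;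
         x∈⁅x⁆; x∈⁅y⁆⇒x≡y; p⊂q⇒∣p∣<∣q∣; ∣p∣≤n)
import Data.Bool as Bool
open import Data.Bool using (_∧_; T)
open import Data.Bool.Properties using (T-≡; T-∧)
open import Data.Vec using (lookup)
open import Data.Vec.Properties using ([]=⇒lookup; lookup⇒[]=; lookup∘tabulate; ≡-dec)
open import Data.List using (List; []; _∷_; _++_; allFin; concat)
import Data.List as List
open import Data.List.Relation.Unary.All using (All; []; _∷_)
import Data.List.Relation.Unary.All as All
open import Data.List.Relation.Unary.All.Properties using (concat⁺; tabulate⁺)
import Data.List.Relation.Unary.Any as Any
open import Data.List.Relation.Unary.Any.Properties using (any⁺; any⁻)
open import Data.List.Membership.Propositional.Properties using (∈-allFin)
open import Data.Product using (Σ; ∃; _,_; proj₁; proj₂)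
open import Data.Sum using (_⊎_; inj₁; inj₂)
open import Data.Empty using (⊥-elim)
open import Data.Unit using (tt)
import Data.Integer as ℤ
open import Data.Rational using (ℚ; 0ℚ; _*_; _+_; _/_; _≤_)
open import Data.Rational.Properties using (*-zeroʳ; +-identityˡ; +-identityʳ; +-assoc)
open import Relation.Binary.PropositionalEquality
open import Relation.Nullary using (¬_; yes; no)
open import Relation.Nullary.Decidable using (_→-dec_)
open import Function using (id; _∘_)
open import Function.Bundles using (mk⇔; Equivalence)
open import Function.Construct.Composition using (_⇔-∘_)
open import Function.Construct.Symmetry using (⇔-sym)

∀-⇔ : ∀ {k} {A B : Fin k → Set} → (∀ i → A i ⇔ B i) → (∀ i → A i) ⇔ (∀ i → B i)
∀-⇔ eq = mk⇔ (λ a i → Equivalence.to (eq i) (a i)) (λ b i → Equivalence.from (eq i) (b i))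

∪-inl : ∀ {n} {A B : Subset n} → A ⊆ A ∪ B
∪-inl {B = B} = p⊆p∪q B

∪-inr : ∀ {n} {A B : Subset n} → B ⊆ A ∪ B
∪-inr {A = A} {B} = q⊆p∪q A B

∪-least : ∀ {n} {A B C : Subset n} → A ⊆ C → B ⊆ C → A ∪ B ⊆ C
∪-least {A = A} {B} A⊆C B⊆C x∈A∪B with x∈p∪q⁻ A B x∈A∪B
... | inj₁ x∈A = A⊆C x∈A
... | inj₂ x∈B = B⊆C x∈B

Generator : ∀ {n} → Family n → ℚ × Subset n → Set
Generator 𝒯 p = (0ℚ ≤ proj₁ p) × 𝒯 (proj₂ p)

module _ {n : ℕ} (G : Graph n) where

  adjacent-sym : ∀ {u v} → Adjacent G u v → Adjacent G v u
  adjacent-sym {u} {v} a = trans (sym (adj-sym G u v)) a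

  walk-end : ∀ {A u v} → Path G A u v → v ∈ A
  walk-end (stop v∈A)   = v∈A
  walk-end (step _ _ p) = walk-end p

  walk-widen : ∀ {A B u v} → A ⊆ B → Path G A u v → Path G B u v
  walk-widen A⊆B (stop u∈A)     = stop (A⊆B u∈A)
  walk-widen A⊆B (step u∈A a p) = step (A⊆B u∈A) a (walk-widen A⊆B p)

  walk-append : ∀ {A u w v} → Path G A u w → Path G A w v → Path G A u v
  walk-append (stop _)       q = q
  walk-append (step u∈A a p) q = step u∈A a (walk-append p q)

  walk-snoc : ∀ {A u w v} → Path G A u w → Adjacent G w v → v ∈ A → Path G A u v
  walk-snoc p a v∈A = walk-append p (step (walk-end p) a (stop v∈A))

  walk-reverse : ∀ {A u v} → Path G A u v → Path G A v u
  walk-reverse (stop u∈A)     = stop u∈A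
  walk-reverse (step u∈A a p) = walk-snoc (walk-reverse p) (adjacent-sym a) u∈A

  ∪-connected : ∀ {A B a b} → Connected G A → Connected G B → a ∈ A → b ∈ B →
                Path G (A ∪ B) a b → Connected G (A ∪ B)
  ∪-connected {A} {B} {a} {b} (_ , walkA) (_ , walkB) a∈A b∈B bridge =
    (a , ∪-inl a∈A) , λ x∈ y∈ → walk (x∈p∪q⁻ A B x∈) (x∈p∪q⁻ A B y∈)
    where
      walk : ∀ {x y} → x ∈ A ⊎ x ∈ B → y ∈ A ⊎ y ∈ B → Path G (A ∪ B) x y
      walk (inj₁ x∈A) (inj₁ y∈A) = walk-widen ∪-inl (walkA x∈A y∈A)
      walk (inj₁ x∈A) (inj₂ y∈B) =
        walk-append (walk-widen ∪-inl (walkA x∈A a∈A))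
                    (walk-append bridge (walk-widen ∪-inr (walkB b∈B y∈B)))
      walk (inj₂ x∈B) (inj₁ y∈A) = walk-reverse (walk (inj₁ y∈A) (inj₂ x∈B))
      walk (inj₂ x∈B) (inj₂ y∈B) = walk-widen ∪-inr (walkB x∈B y∈B)

  nbr-intro : ∀ {A w u} → w ∈ A → Adjacent G w u → u ∈ nbr G A
  nbr-intro {A} {w} {u} w∈A a =
    lookup⇒[]= u (nbr G A)
      (trans (lookup∘tabulate _ u)
        (Equivalence.to T-≡ (any⁺ _ (Any.map witness (∈-allFin w)))))
    where
      witness : ∀ {x} → w ≡ x → T (lookup A x ∧ adj G x u)
      witness refl = subst T (sym (cong₂ _∧_ ([]=⇒lookup w∈A) a)) tt

  nbr-elim : ∀ {A u} → u ∈ nbr G A → ∃ λ w → w ∈ A × Adjacent G w u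
  nbr-elim {A} {u} u∈N
    with Any.satisfied (any⁻ _ (allFin n)
           (Equivalence.from T-≡ (trans (sym (lookup∘tabulate _ u)) ([]=⇒lookup u∈N))))
  ... | w , t with Equivalence.to T-∧ t
  ... | w∈A , a = w , lookup⇒[]= w A (Equivalence.to T-≡ w∈A) , Equivalence.to T-≡ a

  walk-trapped : ∀ {C D a b} → nbr G C ⊆ C → Path G D a b → a ∈ C → b ∈ C
  walk-trapped closed (stop _)     a∈C = a∈C
  walk-trapped closed (step _ e p) a∈C = walk-trapped closed p (closed (nbr-intro a∈C e))

  close : ℕ → Subset n → Subset n
  close zero    A = A
  close (suc k) A with nbr G A ⊆? A
  ... | yes _ = A
  ... | no _  = close k (A ∪ nbr G A)

  close-⊇ : ∀ k A → A ⊆ close k A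
  close-⊇ zero    A x∈A = x∈A
  close-⊇ (suc k) A x∈A with nbr G A ⊆? A
  ... | yes _ = x∈A
  ... | no _  = close-⊇ k _ (∪-inl x∈A)

  close-reachable : ∀ {v} k A → (∀ {u} → u ∈ A → Path G A v u) →
                    ∀ {u} → u ∈ close k A → Path G (close k A) v u
  close-reachable zero A reach = reach
  close-reachable {v} (suc k) A reach with nbr G A ⊆? A
  ... | yes _ = reach
  ... | no _  = close-reachable k _ reach′
    where
      reach′ : ∀ {u} → u ∈ A ∪ nbr G A → Path G (A ∪ nbr G A) v u
      reach′ {u} u∈ with x∈p∪q⁻ A (nbr G A) u∈
      ... | inj₁ u∈A = walk-widen ∪-inl (reach u∈A)
      ... | inj₂ u∈N with nbr-elim u∈N
      ...   | w , w∈A , a = walk-snoc (walk-widen ∪-inl (reach w∈A)) a u∈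

  grow-strict : ∀ A → ¬ (nbr G A ⊆ A) → ∣ A ∣ ℕ.< ∣ A ∪ nbr G A ∣
  grow-strict A not-closed = p⊂q⇒∣p∣<∣q∣ (∪-inl , new-vertex)
    where
      new-vertex : ∃ λ x → x ∈ A ∪ nbr G A × x ∉ A
      new-vertex with Fin.¬∀⟶∃¬ n (λ x → x ∈ nbr G A → x ∈ A)
                        (λ x → (x ∈? nbr G A) →-dec (x ∈? A)) (λ f → not-closed (f _))
      ... | x , ¬sub with x ∈? nbr G A
      ...   | yes x∈N = x , ∪-inr x∈N , λ x∈A → ¬sub (λ _ → x∈A)
      ...   | no  x∉N = ⊥-elim (¬sub (⊥-elim ∘ x∉N))

  close-closed-or-large : ∀ k A → nbr G (close k A) ⊆ close k A ⊎ k ℕ.+ ∣ A ∣ ℕ.≤ ∣ close k A ∣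
  close-closed-or-large zero A = inj₂ ℕₚ.≤-refl
  close-closed-or-large (suc k) A with nbr G A ⊆? A
  ... | yes closed = inj₁ closed
  ... | no not-closed with close-closed-or-large k (A ∪ nbr G A)
  ...   | inj₁ closed = inj₁ closed
  ...   | inj₂ large  = inj₂ (ℕₚ.≤-trans (ℕₚ.≤-reflexive (sym (ℕₚ.+-suc k ∣ A ∣)))
                                 (ℕₚ.≤-trans (ℕₚ.+-monoʳ-≤ k (grow-strict A not-closed)) large))

  -- Every vertex lies in a connected component of G: the neighbourhood
  -- closure of {v} after n + 1 steps (it must be closed, having ≤ n vertices).
  vertex-component : ∀ v → ∃ λ C → IsComponent G ⊤ C × v ∈ C
  vertex-component v = C , ((⊆⊤ , (v , v∈C) , connected) , maximal) , v∈C
    where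
      C = close (suc n) ⁅ v ⁆
      v∈C : v ∈ C
      v∈C = close-⊇ (suc n) _ (x∈⁅x⁆ v)
      reach : ∀ {u} → u ∈ C → Path G C v u
      reach = close-reachable (suc n) ⁅ v ⁆
                (λ u∈ → subst (Path G ⁅ v ⁆ v) (sym (x∈⁅y⁆⇒x≡y v u∈)) (stop (x∈⁅x⁆ v)))
      connected : ∀ {x y} → x ∈ C → y ∈ C → Path G C x y
      connected x∈C y∈C = walk-append (walk-reverse (reach x∈C)) (reach y∈C)
      closed : nbr G C ⊆ C
      closed with close-closed-or-large (suc n) ⁅ v ⁆
      ... | inj₁ c     = c
      ... | inj₂ large =
        ⊥-elim (ℕₚ.n≮n n (ℕₚ.≤-trans (ℕₚ.m+n≤o⇒m≤o (suc n) large) (∣p∣≤n C)))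
      maximal : ∀ D → IsTube G ⊤ D → C ⊆ D → D ≡ C
      maximal D (_ , _ , walkD) C⊆D =
        ⊆-antisym (λ u∈D → walk-trapped closed (walkD (C⊆D v∈C) u∈D) v∈C) C⊆D

  tubing-member : ∀ {W 𝒯 T} → IsTubing G W 𝒯 → 𝒯 T → T ⊆ W × Nonempty T
  tubing-member (proper , _) T∈𝒯 with proper _ T∈𝒯
  ... | (T⊆W , T≠∅ , _) , _ = T⊆W , T≠∅

  tubing-cong : ∀ {W 𝒯 𝒯'} → 𝒯 ≐ᶠ 𝒯' → IsTubing G W 𝒯' → IsTubing G W 𝒯
  tubing-cong (to , _) (proper , compatible) =
    (λ T t → proper T (to T t)) , (λ T T' t t' → compatible T T' (to T t) (to T' t'))

  InCone-cong : ∀ {𝒯° 𝒯 𝒯'} → 𝒯 ≐ᶠ 𝒯' → ∀ x → InCone G 𝒯° 𝒯 x ⇔ InCone G 𝒯° 𝒯' x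
  InCone-cong (to , from) x =
    mk⇔ (λ (l , gens , eq) → l , All.map (λ (c≥0 , t) → c≥0 , to _ t) gens , eq)
        (λ (l , gens , eq) → l , All.map (λ (c≥0 , t) → c≥0 , from _ t) gens , eq)

  Separated : Subset n → Subset n → Set
  Separated S T = (∀ {u} → u ∈ S → u ∉ T) × (∀ {u w} → u ∈ S → w ∈ T → ¬ Adjacent G u w)

  -- δ(S ‖ T) = 0 for S nonempty and separated from T: S ≠ T, S ⊈ T, and no
  -- vertex of T is a neighbour of S.
  δ-separated : ∀ {S T} → Nonempty S → Separated S T → δ G S T ≡ 0ℚ
  δ-separated {S} {T} (s , s∈S) (disjoint , no-edge) with ≡-dec Bool._≟_ S T
  ... | yes refl = ⊥-elim (disjoint s∈S s∈S)
  ... | no _ with S ⊆? T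
  ...   | yes S⊆T = ⊥-elim (disjoint s∈S (S⊆T s∈S))
  ...   | no _    = cong (λ m → ℤ.+ m / 1) (trans (cong ∣_∣ (Empty-unique no-neighbour)) (∣⊥∣≡0 n))
    where
      no-neighbour : Empty ((T ─ S) ∩ nbr G S)
      no-neighbour (w , w∈) with x∈p∩q⁻ (T ─ S) (nbr G S) w∈
      ... | w∈T─S , w∈N with nbr-elim w∈N
      ...   | u , u∈S , a = no-edge u∈S (p─q⊆p T S w∈T─S) a

  lincomb-drop-separated : ∀ {S} c T l → Nonempty S → Separated S T →
                           lincomb G ((c , T) ∷ l) S ≡ lincomb G l S
  lincomb-drop-separated {S} c T l S≠∅ sep = begin
    c * δ G S T + lincomb G l S ≡⟨ cong (λ d → c * d + lincomb G l S) (δ-separated S≠∅ sep) ⟩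
    c * 0ℚ + lincomb G l S      ≡⟨ cong (_+ lincomb G l S) (*-zeroʳ c) ⟩
    0ℚ + lincomb G l S          ≡⟨ +-identityˡ _ ⟩
    lincomb G l S               ∎
    where open ≡-Reasoning

  lincomb-separated : ∀ {S} l → Nonempty S → All (λ p → Separated S (proj₂ p)) l →
                      lincomb G l S ≡ 0ℚ
  lincomb-separated []            S≠∅ []           = refl
  lincomb-separated ((c , T) ∷ l) S≠∅ (sep ∷ seps) =
    trans (lincomb-drop-separated c T l S≠∅ sep) (lincomb-separated l S≠∅ seps)

  lincomb-++ : ∀ l l' S → lincomb G (l ++ l') S ≡ lincomb G l S + lincomb G l' S
  lincomb-++ []            l' S = sym (+-identityˡ _)
  lincomb-++ ((c , T) ∷ l) l' S =
    trans (cong (c * δ G S T +_) (lincomb-++ l l' S))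
          (sym (+-assoc (c * δ G S T) (lincomb G l S) (lincomb G l' S)))

  lincomb-concat-zero : ∀ {k} (ls : Fin k → List (ℚ × Subset n)) S →
                        (∀ j → lincomb G (ls j) S ≡ 0ℚ) →
                        lincomb G (concat (List.tabulate ls)) S ≡ 0ℚ
  lincomb-concat-zero {zero}  ls S zeros = refl
  lincomb-concat-zero {suc k} ls S zeros =
    trans (lincomb-++ (ls fzero) _ S)
          (trans (cong₂ _+_ (zeros fzero) (lincomb-concat-zero (ls ∘ fsuc) S (zeros ∘ fsuc)))
                 (+-identityˡ 0ℚ))

  lincomb-concat-single : ∀ {k} (ls : Fin k → List (ℚ × Subset n)) S i →
                          (∀ j → j ≢ i → lincomb G (ls j) S ≡ 0ℚ) →
                          lincomb G (concat (List.tabulate ls)) S ≡ lincomb G (ls i) S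
  lincomb-concat-single ls S fzero others =
    trans (lincomb-++ (ls fzero) _ S)
          (trans (cong (lincomb G (ls fzero) S +_)
                       (lincomb-concat-zero (ls ∘ fsuc) S (λ j → others (fsuc j) λ ())))
                 (+-identityʳ _))
  lincomb-concat-single ls S (fsuc i) others =
    trans (lincomb-++ (ls fzero) _ S)
          (trans (cong₂ _+_ (others fzero λ ())
                            (lincomb-concat-single (ls ∘ fsuc) S i
                               (λ j j≢i → others (fsuc j) (j≢i ∘ Fin.suc-injective))))
                 (+-identityˡ _))

  module Components {k} (Cs : Fin k → Subset n) (isList : IsComponentList G Cs) where

    component : ∀ i → IsComponent G ⊤ (Cs i)
    component = proj₁ isList

    component-connected : ∀ i → Connected G (Cs i)
    component-connected i = proj₂ (proj₁ (component i))

    component-absorbs : ∀ {X x} i → Connected G X → x ∈ X → x ∈ Cs i → X ⊆ Cs i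
    component-absorbs {X} i X-conn x∈X x∈Cᵢ {y} y∈X = subst (y ∈_) X∪Cᵢ≡Cᵢ (∪-inl y∈X)
      where
        X∪Cᵢ≡Cᵢ : X ∪ Cs i ≡ Cs i
        X∪Cᵢ≡Cᵢ = proj₂ (component i) (X ∪ Cs i)
                    (⊆⊤ , ∪-connected X-conn (component-connected i) x∈X x∈Cᵢ (stop (∪-inl x∈X)))
                    ∪-inr

    component-unique : ∀ {x} i j → x ∈ Cs i → x ∈ Cs j → i ≡ j
    component-unique i j x∈Cᵢ x∈Cⱼ =
      proj₁ (proj₂ isList) i j
        (⊆-antisym (component-absorbs j (component-connected i) x∈Cᵢ x∈Cⱼ)
                   (component-absorbs i (component-connected j) x∈Cⱼ x∈Cᵢ))

    edge-within-component : ∀ {u w} i j → u ∈ Cs i → Adjacent G u w → w ∈ Cs j → i ≡ j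
    edge-within-component i j u∈Cᵢ a w∈Cⱼ =
      component-unique i j
        (component-absorbs i
           (∪-connected (component-connected i) (component-connected j) u∈Cᵢ w∈Cⱼ
              (step (∪-inl u∈Cᵢ) a (stop (∪-inr w∈Cⱼ))))
           (∪-inl u∈Cᵢ) u∈Cᵢ (∪-inr w∈Cⱼ))
        w∈Cⱼ

    separated-across : ∀ {S T} i j → j ≢ i → S ⊆ Cs i → T ⊆ Cs j → Separated S T
    separated-across i j j≢i S⊆Cᵢ T⊆Cⱼ =
      (λ u∈S u∈T → j≢i (component-unique j i (T⊆Cⱼ u∈T) (S⊆Cᵢ u∈S))) ,
      (λ u∈S w∈T a → j≢i (sym (edge-within-component i j (S⊆Cᵢ u∈S) a (T⊆Cⱼ w∈T))))

    connected-in-component : ∀ {T} → Connected G T → ∃ λ i → T ⊆ Cs i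
    connected-in-component T-conn@((v , v∈T) , _) with vertex-component v
    ... | C , C-comp , v∈C with proj₂ (proj₂ isList) C C-comp
    ...   | i , refl = i , component-absorbs i T-conn v∈T v∈C

    proper-restrict : ∀ {T} i → IsProperTube G ⊤ T → T ⊆ Cs i → IsProperTube G (Cs i) T
    proper-restrict i ((_ , T-conn) , not-comp) T⊆Cᵢ = (T⊆Cᵢ , T-conn) , λ comp →
      not-comp (subst (IsComponent G ⊤)
                      (proj₂ comp (Cs i) (id , component-connected i) T⊆Cᵢ) (component i))

    proper-extend : ∀ {T} i → IsProperTube G (Cs i) T → IsProperTube G ⊤ T
    proper-extend i ((T⊆Cᵢ , T-conn) , not-comp) = (⊆⊤ , T-conn) , λ comp →
      not-comp (subst (IsComponent G (Cs i))
                      (proj₂ comp (Cs i) (proj₁ (component i)) T⊆Cᵢ) Cᵢ-component-of-itself)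
      where
        Cᵢ-component-of-itself : IsComponent G (Cs i) (Cs i)
        Cᵢ-component-of-itself =
          (id , component-connected i) , λ D D-tube Cᵢ⊆D → ⊆-antisym (proj₁ D-tube) Cᵢ⊆D

    compatible-restrict : ∀ {T T'} i → Compatible G ⊤ T T' → Compatible G (Cs i) T T'
    compatible-restrict i (inj₁ T⊆T')                    = inj₁ T⊆T'
    compatible-restrict i (inj₂ (inj₁ T'⊆T))             = inj₂ (inj₁ T'⊆T)
    compatible-restrict i (inj₂ (inj₂ (disj , not-tube))) =
      inj₂ (inj₂ (disj , λ tube → not-tube (⊆⊤ , proj₂ tube)))

    compatible-extend : ∀ {T T'} i → T ⊆ Cs i → T' ⊆ Cs i →
                        Compatible G (Cs i) T T' → Compatible G ⊤ T T'
    compatible-extend i _ _ (inj₁ T⊆T')                    = inj₁ T⊆T'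
    compatible-extend i _ _ (inj₂ (inj₁ T'⊆T))             = inj₂ (inj₁ T'⊆T)
    compatible-extend i T⊆Cᵢ T'⊆Cᵢ (inj₂ (inj₂ (disj , not-tube))) =
      inj₂ (inj₂ (disj , λ tube → not-tube (∪-least T⊆Cᵢ T'⊆Cᵢ , proj₂ tube)))

    -- Nonempty sets in different components are compatible: disjoint, and
    -- a connected union would lie in one component.
    compatible-across : ∀ {T T'} i j → j ≢ i → T ⊆ Cs i → T' ⊆ Cs j →
                        Nonempty T → Nonempty T' → Compatible G ⊤ T T'
    compatible-across {T} {T'} i j j≢i T⊆Cᵢ T'⊆Cⱼ (t , t∈T) (t' , t'∈T') =
      inj₂ (inj₂ (disjoint , not-tube))
      where
        disjoint : Empty (T ∩ T')
        disjoint (x , x∈) with x∈p∩q⁻ T T' x∈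
        ... | x∈T , x∈T' = proj₁ (separated-across i j j≢i T⊆Cᵢ T'⊆Cⱼ) x∈T x∈T'
        not-tube : ¬ IsTube G ⊤ (T ∪ T')
        not-tube (_ , union-conn) =
          j≢i (component-unique j i (T'⊆Cⱼ t'∈T')
                 (component-absorbs i union-conn (∪-inl t∈T) (T⊆Cᵢ t∈T) (∪-inr t'∈T')))

    restrict : Family n → Fin k → Family n
    restrict 𝒯 i T = 𝒯 T × T ⊆ Cs i

    restrict-tubing : ∀ {𝒯} → IsTubing G ⊤ 𝒯 → ∀ i → IsTubing G (Cs i) (restrict 𝒯 i)
    restrict-tubing (proper , compatible) i =
      (λ T (T∈𝒯 , T⊆Cᵢ) → proper-restrict i (proper T T∈𝒯) T⊆Cᵢ) ,
      (λ T T' t t' → compatible-restrict i (compatible T T' (proj₁ t) (proj₁ t')))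

    restrict-covers : ∀ {𝒯} → IsTubing G ⊤ 𝒯 → 𝒯 ≐ᶠ ⋃ᶠ (restrict 𝒯)
    restrict-covers (proper , _) =
      (λ T T∈𝒯 → let (i , T⊆Cᵢ) = connected-in-component (proj₂ (proj₁ (proper T T∈𝒯)))
                 in i , T∈𝒯 , T⊆Cᵢ) ,
      (λ T (_ , T∈𝒯 , _) → T∈𝒯)

    glue-tubing : ∀ (F : Fin k → Family n) → (∀ i → IsTubing G (Cs i) (F i)) →
                  IsTubing G ⊤ (⋃ᶠ F)
    glue-tubing F tubings = proper , compatible
      where
        proper : ∀ T → ⋃ᶠ F T → IsProperTube G ⊤ T
        proper T (i , T∈Fᵢ) = proper-extend i (proj₁ (tubings i) T T∈Fᵢ)
        compatible : ∀ T T' → ⋃ᶠ F T → ⋃ᶠ F T' → Compatible G ⊤ T T'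
        compatible T T' (i , T∈Fᵢ) (j , T'∈Fⱼ)
          with tubing-member (tubings i) T∈Fᵢ | tubing-member (tubings j) T'∈Fⱼ | j ≟ᶠ i
        ... | T⊆Cᵢ , _ | T'⊆Cⱼ , _ | yes refl =
          compatible-extend i T⊆Cᵢ T'⊆Cⱼ (proj₂ (tubings i) T T' T∈Fᵢ T'∈Fⱼ)
        ... | T⊆Cᵢ , T≠∅ | T'⊆Cⱼ , T'≠∅ | no j≢i =
          compatible-across i j j≢i T⊆Cᵢ T'⊆Cⱼ T≠∅ T'≠∅

    restrict-combination :
      ∀ (F : Fin k → Family n) → (∀ j T → F j T → T ⊆ Cs j) → ∀ i l →
      All (Generator (⋃ᶠ F)) l →
      Σ (List (ℚ × Subset n)) λ l' → All (Generator (F i)) l'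
        × (∀ S → S ⊆ Cs i → Nonempty S → lincomb G l S ≡ lincomb G l' S)
    restrict-combination F inside i [] [] = [] , [] , λ _ _ _ → refl
    restrict-combination F inside i ((c , T) ∷ l) ((c≥0 , j , T∈Fⱼ) ∷ gens)
      with restrict-combination F inside i l gens | j ≟ᶠ i
    ... | l' , gens' , same | yes refl =
      (c , T) ∷ l' , (c≥0 , T∈Fⱼ) ∷ gens' ,
      λ S S⊆Cᵢ S≠∅ → cong (c * δ G S T +_) (same S S⊆Cᵢ S≠∅)
    ... | l' , gens' , same | no j≢i =
      l' , gens' , λ S S⊆Cᵢ S≠∅ →
        trans (lincomb-drop-separated c T l S≠∅ (separated-across i j j≢i S⊆Cᵢ (inside j T T∈Fⱼ)))
              (same S S⊆Cᵢ S≠∅)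

    -- The cone of a union of families, restricted to the coordinates 𝒯°ᵢ in
    -- the components, is the product of the component cones: a combination
    -- splits into its component parts, and the parts concatenate back since
    -- at a coordinate in Cᵢ only the i-th part contributes.
    cone-split :
      ∀ (Ts F : Fin k → Family n) →
      (∀ i S → Ts i S → S ⊆ Cs i × Nonempty S) → (∀ j T → F j T → T ⊆ Cs j) →
      ∀ x → InCone G (⋃ᶠ Ts) (⋃ᶠ F) x ⇔ (∀ i → InCone G (Ts i) (F i) x)
    cone-split Ts F coordinates inside x = mk⇔ split glue
      where
        split : InCone G (⋃ᶠ Ts) (⋃ᶠ F) x → ∀ i → InCone G (Ts i) (F i) x
        split (l , gens , value) i with restrict-combination F inside i l gens
        ... | l' , gens' , same =
          l' , gens' , λ S S∈Tsᵢ →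
            trans (value S (i , S∈Tsᵢ))
                  (same S (proj₁ (coordinates i S S∈Tsᵢ)) (proj₂ (coordinates i S S∈Tsᵢ)))

        glue : (∀ i → InCone G (Ts i) (F i) x) → InCone G (⋃ᶠ Ts) (⋃ᶠ F) x
        glue cones = concat (List.tabulate ls) , concat⁺ (tabulate⁺ gens) , value
          where
            ls : Fin k → List (ℚ × Subset n)
            ls i = proj₁ (cones i)
            gensᵢ : ∀ i → All (Generator (F i)) (ls i)
            gensᵢ i = proj₁ (proj₂ (cones i))
            gens : ∀ i → All (Generator (⋃ᶠ F)) (ls i)
            gens i = All.map (λ (c≥0 , T∈Fᵢ) → c≥0 , i , T∈Fᵢ) (gensᵢ i)
            value : ∀ S → ⋃ᶠ Ts S → x S ≡ lincomb G (concat (List.tabulate ls)) S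
            value S (i , S∈Tsᵢ) =
              trans (proj₂ (proj₂ (cones i)) S S∈Tsᵢ) (sym (lincomb-concat-single ls S i others))
              where
                others : ∀ j → j ≢ i → lincomb G (ls j) S ≡ 0ℚ
                others j j≢i =
                  lincomb-separated (ls j) (proj₂ (coordinates i S S∈Tsᵢ))
                    (All.map (λ (_ , T∈Fⱼ) → separated-across i j j≢i
                                 (proj₁ (coordinates i S S∈Tsᵢ)) (inside j _ T∈Fⱼ))
                             (gensᵢ j))

    nested-complex-join :
      (𝒯 : Family n) → NestedComplex G ⊤ 𝒯 ⇔ Join (λ i → NestedComplex G (Cs i)) 𝒯
    nested-complex-join 𝒯 = mk⇔
      (λ (Level.lift tubing) →
         restrict 𝒯 , (λ i → Level.lift (restrict-tubing tubing i)) , restrict-covers tubing)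
      (λ (F , tubings , 𝒯≐⋃F) →
         Level.lift (tubing-cong 𝒯≐⋃F (glue-tubing F (Level.lower ∘ tubings))))

    compatibility-fan-product :
      (Ts : Fin k → Family n) → (∀ i → IsMaximalTubing G (Cs i) (Ts i)) →
      (K : Cone n) → InFan G ⊤ (⋃ᶠ Ts) K ⇔ InProductFan G Cs Ts K
    compatibility-fan-product Ts maximal K = mk⇔ split glue
      where
        coordinates : ∀ i S → Ts i S → S ⊆ Cs i × Nonempty S
        coordinates i S = tubing-member (proj₁ (maximal i))

        split : InFan G ⊤ (⋃ᶠ Ts) K → InProductFan G Cs Ts K
        split (𝒯 , tubing , K≐) =
          (λ i → InCone G (Ts i) (restrict 𝒯 i)) ,
          (λ i → restrict 𝒯 i , restrict-tubing tubing i , λ x → mk⇔ id id) ,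
          λ x → cone-split Ts (restrict 𝒯) coordinates (λ j T → proj₂) x
                ⇔-∘ (InCone-cong (restrict-covers tubing) x ⇔-∘ K≐ x)

        glue : InProductFan G Cs Ts K → InFan G ⊤ (⋃ᶠ Ts) K
        glue (Ks , fans , K≐) = ⋃ᶠ F , glue-tubing F tubings ,
          λ x → ⇔-sym (cone-split Ts F coordinates inside x)
                ⇔-∘ (∀-⇔ (λ i → proj₂ (proj₂ (fans i)) x) ⇔-∘ K≐ x)
          where
            F : Fin k → Family n
            F i = proj₁ (fans i)
            tubings : ∀ i → IsTubing G (Cs i) (F i)
            tubings i = proj₁ (proj₂ (fans i))
            inside : ∀ j T → F j T → T ⊆ Cs j
            inside j T T∈Fⱼ = proj₁ (tubing-member (tubings j) T∈Fⱼ)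

proposition5p1 : ∀ {n} (G : Graph n) (k : ℕ) (Cs : Fin k → Subset n) →
    IsComponentList G Cs →
    ((𝒯 : Family n) →
      NestedComplex G ⊤ 𝒯 ⇔ Join (λ i → NestedComplex G (Cs i)) 𝒯)
    × ((Ts : Fin k → Family n) →
      (∀ i → IsMaximalTubing G (Cs i) (Ts i)) →
      (K : Cone n) →
      InFan G ⊤ (⋃ᶠ Ts) K ⇔ InProductFan G Cs Ts K)
proposition5p1 G k Cs isList = nested-complex-join , compatibility-fan-product
  where open Components G Cs isList
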